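{- Let $\mathbf{L}$ be a De Morgan semi-Heyting algebra and let $n \in \omega$. Then $\mathbf{L}$ is at level $n+1$ (i.e. $\mathbf{L}$ satisfies the identity $t_{n+1}(x) \approx t_{n+2}(x)$) if and only if $\mathbf{L}$ satisfies the identity $$(x \land (x')^*)^{n('^*)} \approx (x \land (x')^*)^{(n+1)('^*)}.$$
   Context: A semi-Heyting algebra is an algebra $\langle L,\vee,\wedge,\to,0,1\rangle$ such that $\langle L,\vee,\wedge,0,1\rangle$ is a bounded lattice and the identities $x\wedge(x\to y)\approx x\wedge y$, $x\wedge(y\to z)\approx x\wedge[(x\wedge y)\to(x\wedge z)]$, and $x\to x\approx 1$ hold. Such algebras are distributive and pseudocomplemented, with pseudocomplement $x^* := x\to 0$. A dually quasi-De Morgan semi-Heyting algebra ($\mathbf{DQD}$-algebra) is an algebra $\langle L,\vee,\wedge,\to,{}',0,1\rangle$ whose reduct $\langle L,\vee,\wedge,\to,0,1\rangle$ is a semi-Heyting algebra and which satisfies $0'\approx 1$, $1'\approx 0$, $(x\wedge y)'\approx x'\vee y'$, $(x\vee y)''\approx x''\vee y''$, and $x''\le x$. A De Morgan semi-Heyting algebra is a $\mathbf{DQD}$-algebra satisfying $x''\approx x$. Notation: $x'^*$ means $(x')^*$. Define $x^{0('^*)} := x$ and $x^{(k+1)('^*)} := ((x^{k('^*)})')^*$ for $k\ge 0$; define $t_0(x):=x$ and $t_{k+1}(x) := t_k(x)\wedge x^{(k+1)('^*)}$. An algebra is said to be at level $m$ if it satisfies the identity $t_m(x)\approx t_{m+1}(x)$.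 -}

module Defs where

open import Level using (Level; suc)
open import Data.Nat using (ℕ; zero) renaming (suc to nsuc)
open import Relation.Binary.PropositionalEquality using (_≡_)

record DeMorganSemiHeyting (ℓ : Level) : Set (suc ℓ) where
  infixr 6 _∨_
  infixr 7 _∧_
  infixr 5 _⇒_
  field
    Carrier : Set ℓ
    _∨_ _∧_ _⇒_ : Carrier → Carrier → Carrier
    _′ : Carrier → Carrier
    𝟘 𝟙 : Carrier
    ∨-comm   : ∀ x y → x ∨ y ≡ y ∨ x
    ∧-comm   : ∀ x y → x ∧ y ≡ y ∧ x
    ∨-assoc  : ∀ x y z → (x ∨ y) ∨ z ≡ x ∨ (y ∨ z)
    ∧-assoc  : ∀ x y z → (x ∧ y) ∧ z ≡ x ∧ (y ∧ z)
    ∨-absorb : ∀ x y → x ∨ (x ∧ y) ≡ x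
    ∧-absorb : ∀ x y → x ∧ (x ∨ y) ≡ x
    𝟘-least  : ∀ x → 𝟘 ∧ x ≡ 𝟘
    𝟙-greatest : ∀ x → x ∧ 𝟙 ≡ x
    sh1 : ∀ x y → x ∧ (x ⇒ y) ≡ x ∧ y
    sh2 : ∀ x y z → x ∧ (y ⇒ z) ≡ x ∧ ((x ∧ y) ⇒ (x ∧ z))
    sh3 : ∀ x → x ⇒ x ≡ 𝟙
    dq1 : 𝟘 ′ ≡ 𝟙
    dq2 : 𝟙 ′ ≡ 𝟘
    dq3 : ∀ x y → (x ∧ y) ′ ≡ (x ′) ∨ (y ′)
    dq4 : ∀ x y → ((x ∨ y) ′) ′ ≡ ((x ′) ′) ∨ ((y ′) ′)
    dq5 : ∀ x → ((x ′) ′) ∧ x ≡ (x ′) ′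
    dm  : ∀ x → (x ′) ′ ≡ x

  _* : Carrier → Carrier
  x * = x ⇒ 𝟘

  -- x^{k('*)}: x^{0('*)} = x, x^{(k+1)('*)} = ((x^{k('*)})')*
  iter′* : ℕ → Carrier → Carrier
  iter′* zero x = x
  iter′* (nsuc k) x = ((iter′* k x) ′) *

  t : ℕ → Carrier → Carrier
  t zero x = x
  t (nsuc k) x = t k x ∧ iter′* (nsuc k) x

  AtLevel : ℕ → Set ℓ
  AtLevel m = ∀ x → t m x ≡ t (nsuc m) x

-- Write φ y = y′* , so that x^{k('*)} = φᵏ x.  The proof rests on two facts
-- about φ in a De Morgan semi-Heyting algebra:
--   (a) φ preserves meets:  φ (u ∧ v) = φ u ∧ φ v
--       (from (u ∧ v)′ = u′ ∨ v′ and (p ∨ q)* = p* ∧ q*);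
--   (b) φ is deflationary in two steps:  φ (φ y) ≤ y
--       (φ(φ y) is disjoint from (φ y)′, while y ∨ (φ y)′ = (y′ ∧ y′*)′ = 1).
-- By (b), t_{k+1}(x) collapses to the meet of two consecutive iterates,
--   t_{k+1}(x) = φᵏ x ∧ φᵏ⁺¹ x,
-- and by (a), φⁿ (x ∧ φ x) = φⁿ x ∧ φⁿ⁺¹ x.  Hence φⁿ (x ∧ x′*) = t_{n+1}(x)
-- for every n, and the two identities of the lemma are literally the same.
module Submission where

open import Defs
open import Data.Nat using (ℕ; suc)
import Data.Nat as ℕ
open import Relation.Binary.PropositionalEquality using (_≡_; refl; sym; trans; cong; cong₂; module ≡-Reasoning)
open import Data.Product using (_×_; _,_)

module Properties {ℓ} (L : DeMorganSemiHeyting ℓ) where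
  open DeMorganSemiHeyting L
  open ≡-Reasoning

  infix 4 _≤_
  _≤_ : Carrier → Carrier → Set ℓ
  x ≤ y = x ∧ y ≡ x

  ∧-idem : ∀ x → x ∧ x ≡ x
  ∧-idem x = trans (cong (x ∧_) (sym (∨-absorb x x))) (∧-absorb x (x ∧ x))

  ≤⇒∨≡ : ∀ {x y} → x ≤ y → x ∨ y ≡ y
  ≤⇒∨≡ {x} {y} x≤y = begin
    x ∨ y           ≡⟨ cong (_∨ y) (sym x≤y) ⟩
    (x ∧ y) ∨ y     ≡⟨ ∨-comm _ _ ⟩
    y ∨ (x ∧ y)     ≡⟨ cong (y ∨_) (∧-comm x y) ⟩
    y ∨ (y ∧ x)     ≡⟨ ∨-absorb y x ⟩
    y               ∎

  ∨≡⇒≤ : ∀ {x y} → x ∨ y ≡ y → x ≤ y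
  ∨≡⇒≤ {x} {y} e = trans (cong (x ∧_) (sym e)) (∧-absorb x y)

  ≤-trans : ∀ {x y z} → x ≤ y → y ≤ z → x ≤ z
  ≤-trans {x} {y} {z} x≤y y≤z = begin
    x ∧ z           ≡⟨ cong (_∧ z) (sym x≤y) ⟩
    (x ∧ y) ∧ z     ≡⟨ ∧-assoc x y z ⟩
    x ∧ (y ∧ z)     ≡⟨ cong (x ∧_) y≤z ⟩
    x ∧ y           ≡⟨ x≤y ⟩
    x               ∎

  ≤-antisym : ∀ {x y} → x ≤ y → y ≤ x → x ≡ y
  ≤-antisym {x} {y} x≤y y≤x = trans (sym x≤y) (trans (∧-comm x y) y≤x)

  x∧y≤x : ∀ x y → x ∧ y ≤ x
  x∧y≤x x y = begin
    (x ∧ y) ∧ x     ≡⟨ ∧-comm _ _ ⟩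
    x ∧ (x ∧ y)     ≡⟨ sym (∧-assoc x x y) ⟩
    (x ∧ x) ∧ y     ≡⟨ cong (_∧ y) (∧-idem x) ⟩
    x ∧ y           ∎

  x∧y≤y : ∀ x y → x ∧ y ≤ y
  x∧y≤y x y = trans (∧-assoc x y y) (cong (x ∧_) (∧-idem y))

  x≤x∨y : ∀ x y → x ≤ x ∨ y
  x≤x∨y = ∧-absorb

  y≤x∨y : ∀ x y → y ≤ x ∨ y
  y≤x∨y x y = trans (cong (y ∧_) (∨-comm x y)) (∧-absorb y x)

  ∧-greatest : ∀ {x y z} → z ≤ x → z ≤ y → z ≤ x ∧ y
  ∧-greatest {x} {y} {z} z≤x z≤y = begin
    z ∧ (x ∧ y)     ≡⟨ sym (∧-assoc z x y) ⟩
    (z ∧ x) ∧ y     ≡⟨ cong (_∧ y) z≤x ⟩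
    z ∧ y           ≡⟨ z≤y ⟩
    z               ∎

  ∨-least : ∀ {x y z} → x ≤ z → y ≤ z → x ∨ y ≤ z
  ∨-least {x} {y} {z} x≤z y≤z = ∨≡⇒≤ (begin
    (x ∨ y) ∨ z     ≡⟨ ∨-assoc x y z ⟩
    x ∨ (y ∨ z)     ≡⟨ cong (x ∨_) (≤⇒∨≡ y≤z) ⟩
    x ∨ z           ≡⟨ ≤⇒∨≡ x≤z ⟩
    z               ∎)

  ∧-mono : ∀ {a b c d} → a ≤ b → c ≤ d → a ∧ c ≤ b ∧ d
  ∧-mono {a} {b} {c} {d} a≤b c≤d =
    ∧-greatest (≤-trans (x∧y≤x a c) a≤b) (≤-trans (x∧y≤y a c) c≤d)

  x∧𝟘≡𝟘 : ∀ x → x ∧ 𝟘 ≡ 𝟘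
  x∧𝟘≡𝟘 x = trans (∧-comm x 𝟘) (𝟘-least x)

  ≤𝟘⇒≡𝟘 : ∀ {x} → x ≤ 𝟘 → x ≡ 𝟘
  ≤𝟘⇒≡𝟘 {x} x≤𝟘 = trans (sym x≤𝟘) (x∧𝟘≡𝟘 x)

  ≡𝟘⇒≤𝟘 : ∀ {x} → x ≡ 𝟘 → x ≤ 𝟘
  ≡𝟘⇒≤𝟘 {x} e = trans (cong (_∧ 𝟘) e) (trans (∧-idem 𝟘) (sym e))

  residuate : ∀ {x y z} → x ∧ y ≤ z → x ≤ y ⇒ (y ∧ z)
  residuate {x} {y} {z} xy≤z = begin
    x ∧ (y ⇒ (y ∧ z))               ≡⟨ sh2 x y (y ∧ z) ⟩
    x ∧ ((x ∧ y) ⇒ (x ∧ (y ∧ z)))   ≡⟨ cong (λ w → x ∧ ((x ∧ y) ⇒ w)) (trans (sym (∧-assoc x y z)) xy≤z) ⟩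
    x ∧ ((x ∧ y) ⇒ (x ∧ y))         ≡⟨ cong (x ∧_) (sh3 _) ⟩
    x ∧ 𝟙                           ≡⟨ 𝟙-greatest x ⟩
    x                               ∎

  modus-ponens : ∀ y z → y ∧ (y ⇒ (y ∧ z)) ≤ z
  modus-ponens y z rewrite sh1 y (y ∧ z) = ≤-trans (x∧y≤y y (y ∧ z)) (x∧y≤y y z)

  distrib : ∀ x y z → x ∧ (y ∨ z) ≤ (x ∧ y) ∨ (x ∧ z)
  distrib x y z = ≤-trans (∧-mono (∧-idem x) y∨z≤x⇒w) (modus-ponens x w)
    where
    w = (x ∧ y) ∨ (x ∧ z)
    y∨z≤x⇒w : y ∨ z ≤ x ⇒ (x ∧ w)
    y∨z≤x⇒w = ∨-least
      (residuate (trans (cong (_∧ w) (∧-comm y x)) (trans (x≤x∨y _ _) (∧-comm x y))))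
      (residuate (trans (cong (_∧ w) (∧-comm z x)) (trans (y≤x∨y _ _) (∧-comm x z))))

  disjoint-covered⇒≤ : ∀ {a b c} → a ∧ b ≡ 𝟘 → c ∨ b ≡ 𝟙 → a ≤ c
  disjoint-covered⇒≤ {a} {b} {c} a∧b≡𝟘 c∨b≡𝟙 =
    ≤-trans (≤-trans a≤a∧[c∨b] (distrib a c b)) (∨-least (x∧y≤y a c) a∧b≤c)
    where
    a≤a∧[c∨b] : a ≤ a ∧ (c ∨ b)
    a≤a∧[c∨b] = trans (sym (∧-assoc a a (c ∨ b)))
                  (trans (cong (_∧ (c ∨ b)) (∧-idem a))
                    (trans (cong (a ∧_) c∨b≡𝟙) (𝟙-greatest a)))
    a∧b≤c : a ∧ b ≤ c
    a∧b≤c = trans (cong (_∧ c) a∧b≡𝟘) (trans (𝟘-least c) (sym a∧b≡𝟘))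

  x∧x*≡𝟘 : ∀ x → x ∧ (x *) ≡ 𝟘
  x∧x*≡𝟘 x = trans (sh1 x 𝟘) (x∧𝟘≡𝟘 x)

  x*∧x≡𝟘 : ∀ x → (x *) ∧ x ≡ 𝟘
  x*∧x≡𝟘 x = trans (∧-comm _ _) (x∧x*≡𝟘 x)

  disjoint⇒≤* : ∀ {z u} → z ∧ u ≡ 𝟘 → z ≤ u *
  disjoint⇒≤* {z} {u} z∧u≡𝟘 = begin
    z ∧ (u ⇒ 𝟘)                 ≡⟨ sh2 z u 𝟘 ⟩
    z ∧ ((z ∧ u) ⇒ (z ∧ 𝟘))     ≡⟨ cong₂ (λ a b → z ∧ (a ⇒ b)) z∧u≡𝟘 (x∧𝟘≡𝟘 z) ⟩
    z ∧ (𝟘 ⇒ 𝟘)                 ≡⟨ cong (z ∧_) (sh3 𝟘) ⟩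
    z ∧ 𝟙                       ≡⟨ 𝟙-greatest z ⟩
    z                           ∎

  *-antitone : ∀ {u v} → u ≤ v → v * ≤ u *
  *-antitone {u} {v} u≤v =
    disjoint⇒≤* (≤𝟘⇒≡𝟘 (≤-trans (∧-mono (∧-idem (v *)) u≤v) (≡𝟘⇒≤𝟘 (x*∧x≡𝟘 v))))

  *-∨ : ∀ p q → (p ∨ q) * ≡ (p *) ∧ (q *)
  *-∨ p q = ≤-antisym
    (∧-greatest (*-antitone (x≤x∨y p q)) (*-antitone (y≤x∨y p q)))
    (disjoint⇒≤* (≤𝟘⇒≡𝟘 (≤-trans (distrib z p q) (∨-least z∧p≤𝟘 z∧q≤𝟘))))
    where
    z = (p *) ∧ (q *)
    z∧p≤𝟘 : z ∧ p ≤ 𝟘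
    z∧p≤𝟘 = ≤-trans (∧-mono (x∧y≤x (p *) (q *)) (∧-idem p)) (≡𝟘⇒≤𝟘 (x*∧x≡𝟘 p))
    z∧q≤𝟘 : z ∧ q ≤ 𝟘
    z∧q≤𝟘 = ≤-trans (∧-mono (x∧y≤y (p *) (q *)) (∧-idem q)) (≡𝟘⇒≤𝟘 (x*∧x≡𝟘 q))

  φ : Carrier → Carrier
  φ y = (y ′) *

  φ-∧ : ∀ u v → φ (u ∧ v) ≡ φ u ∧ φ v
  φ-∧ u v = trans (cong _* (dq3 u v)) (*-∨ (u ′) (v ′))

  φφ≤ : ∀ y → φ (φ y) ≤ y
  φφ≤ y = disjoint-covered⇒≤ (x*∧x≡𝟘 (φ y ′)) (begin
    y ∨ (φ y ′)               ≡⟨ cong (_∨ (φ y ′)) (sym (dm y)) ⟩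
    ((y ′) ′) ∨ (φ y ′)       ≡⟨ sym (dq3 (y ′) (φ y)) ⟩
    ((y ′) ∧ φ y) ′           ≡⟨ cong _′ (x∧x*≡𝟘 (y ′)) ⟩
    𝟘 ′                       ≡⟨ dq1 ⟩
    𝟙                         ∎)

  -- By (b), t_{k+1}(x) is the meet of the two consecutive iterates k and k+1.
  t-suc : ∀ k x → t (suc k) x ≡ iter′* k x ∧ iter′* (suc k) x
  t-suc ℕ.zero x = refl
  t-suc (suc k) x = begin
    t (suc k) x ∧ C   ≡⟨ cong (_∧ C) (t-suc k x) ⟩
    (A ∧ B) ∧ C       ≡⟨ cong (_∧ C) (∧-comm A B) ⟩
    (B ∧ A) ∧ C       ≡⟨ ∧-assoc B A C ⟩
    B ∧ (A ∧ C)       ≡⟨ cong (B ∧_) (trans (∧-comm A C) (φφ≤ A)) ⟩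
    B ∧ C             ∎
    where
    A = iter′* k x
    B = iter′* (suc k) x
    C = iter′* (suc (suc k)) x

  iter-x∧φx : ∀ n x → iter′* n (x ∧ φ x) ≡ iter′* n x ∧ iter′* (suc n) x
  iter-x∧φx ℕ.zero x = refl
  iter-x∧φx (suc n) x = trans (cong φ (iter-x∧φx n x)) (φ-∧ _ _)

  iter-x∧φx≡t : ∀ n x → iter′* n (x ∧ φ x) ≡ t (suc n) x
  iter-x∧φx≡t n x = trans (iter-x∧φx n x) (sym (t-suc n x))

lemma3p1 : ∀ {ℓ} (L : DeMorganSemiHeyting ℓ) (n : ℕ) →
    let open DeMorganSemiHeyting L in
    (AtLevel (suc n) → (∀ x → iter′* n (x ∧ ((x ′) *)) ≡ iter′* (suc n) (x ∧ ((x ′) *))))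
    × ((∀ x → iter′* n (x ∧ ((x ′) *)) ≡ iter′* (suc n) (x ∧ ((x ′) *))) → AtLevel (suc n))
-- Both identities say t_{n+1}(x) ≈ t_{n+2}(x), read through iter-x∧φx≡t.
lemma3p1 L n =
  (λ atLevel x → trans (iter-x∧φx≡t n x) (trans (atLevel x) (sym (iter-x∧φx≡t (suc n) x)))) ,
  (λ identity x → trans (sym (iter-x∧φx≡t n x)) (trans (identity x) (iter-x∧φx≡t (suc n) x)))
  where
  open Properties L using (iter-x∧φx≡t)
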